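{- Every induced submap of a Fitch map is a Fitch map: if $\varepsilon\colon X^{\times}_{\mathrm{irr}}\to\mathcal{P}(M)$ is a Fitch map and $\varepsilon'\colon X'^{\times}_{\mathrm{irr}}\to\mathcal{P}(M')$ satisfies $X'\subseteq X$ and $\varepsilon'(x,y)=\varepsilon(x,y)$ for all $(x,y)\in X'^{\times}_{\mathrm{irr}}$, then $\varepsilon'$ is a Fitch map.
   Context: $X$ is a finite nonempty set, $M$ a finite nonempty set of colors, $X^{\times}_{\mathrm{irr}}=\{(x,y)\in X\times X: x\neq y\}$. A phylogenetic tree on $X$ is a rooted tree whose leaves (non-root vertices of degree $1$) form $X$, whose root has degree $\ge2$ and whose non-root inner vertices have degree $\ge3$; $\mathrm{lca}(x,y)$ is the last common ancestor. An edge-labeled tree $(T,\lambda)$ on $X$ with $M$ is a phylogenetic tree $T$ on $X$ with $\lambda\colon E(T)\to\mathcal{P}(M)$; $e$ is an $m$-edge if $m\in\lambda(e)$. $(T,\lambda)$ explains $\varepsilon$ if for all $(x,y)\in X^{\times}_{\mathrm{irr}}$, $m\in M$: $m\in\varepsilon(x,y)$ iff the path from $\mathrm{lca}(x,y)$ to $y$ contains an $m$-edge; $\varepsilon$ is a Fitch map if some edge-labeled tree explains it. -}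

module Defs where

open import Data.Nat using (ℕ; _≤_)
open import Data.Product using (Σ; _×_; _,_; proj₁; proj₂; ∃)
open import Data.Sum using (_⊎_)
open import Data.List using (List; []; _∷_; _++_; length)
open import Data.List.Membership.Propositional using (_∈_)
open import Data.List.Relation.Unary.All using (All)
open import Data.List.Relation.Unary.Any using (index)
open import Data.List.Relation.Unary.Unique.Propositional using (Unique)
open import Relation.Binary.PropositionalEquality using (_≡_; _≢_)
open import Function.Bundles using (_⇔_)

-- Ambient types: 𝒳 for taxa (leaves), 𝒞 for colors.
-- A finite set X ⊆ 𝒳 is given by a list; a subset of M is a predicate.

module _ {𝒳 𝒞 : Set} where

  -- Rooted trees with edge labels: an inner vertex lists its child edges,
  -- each child edge carrying its label λ(e) (a finite set of colors, as a list)
  -- together with the subtree below it.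
  data Tree : Set where
    leaf : 𝒳 → Tree
    node : List (List 𝒞 × Tree) → Tree

  mutual
    leaves : Tree → List 𝒳
    leaves (leaf x) = x ∷ []
    leaves (node es) = leavesE es

    leavesE : List (List 𝒞 × Tree) → List 𝒳
    leavesE [] = []
    leavesE ((l , t) ∷ es) = leaves t ++ leavesE es

  -- Every inner vertex has at least two children (root degree ≥ 2,
  -- non-root inner vertices degree ≥ 3), and all labels are subsets of M.
  data WF (M : List 𝒞) : Tree → Set where
    wleaf : ∀ x → WF M (leaf x)
    wnode : ∀ {es} → 2 ≤ length es
          → All (λ e → All (_∈ M) (proj₁ e) × WF M (proj₂ e)) es
          → WF M (node es)

  EdgeLabeledTree : List 𝒳 → List 𝒞 → Tree → Set
  EdgeLabeledTree X M T =
    WF M T × Unique (leaves T) × (∀ z → (z ∈ leaves T) ⇔ (z ∈ X))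

  -- The path from the root of T down to leaf y contains an m-edge.
  data Down (m : 𝒞) (y : 𝒳) : Tree → Set where
    here  : ∀ {es l t} → (l , t) ∈ es → y ∈ leaves t → m ∈ l → Down m y (node es)
    there : ∀ {es l t} → (l , t) ∈ es → Down m y t → Down m y (node es)

  -- The path from lca(x,y) to y contains an m-edge.
  data LcaPath (m : 𝒞) (x y : 𝒳) : Tree → Set where
    inside : ∀ {es l t} → (l , t) ∈ es → x ∈ leaves t → y ∈ leaves t
           → LcaPath m x y t → LcaPath m x y (node es)
    split  : ∀ {es l₁ t₁ l₂ t₂} (p : (l₁ , t₁) ∈ es) (q : (l₂ , t₂) ∈ es)
           → index p ≢ index q
           → x ∈ leaves t₁ → y ∈ leaves t₂
           → (m ∈ l₂ ⊎ Down m y t₂)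
           → LcaPath m x y (node es)

  -- ε : X^×_irr → P(M), encoded as a predicate ε x y m  ("m ∈ ε(x,y)").
  IsMap : List 𝒳 → List 𝒞 → (𝒳 → 𝒳 → 𝒞 → Set) → Set
  IsMap X M ε = ∀ x y m → x ∈ X → y ∈ X → x ≢ y → ε x y m → m ∈ M

  Explains : List 𝒳 → List 𝒞 → Tree → (𝒳 → 𝒳 → 𝒞 → Set) → Set
  Explains X M T ε = ∀ x y m → x ∈ X → y ∈ X → x ≢ y → m ∈ M
                   → ε x y m ⇔ LcaPath m x y T

  FitchMap : List 𝒳 → List 𝒞 → (𝒳 → 𝒳 → 𝒞 → Set) → Set
  FitchMap X M ε = Σ Tree λ T → EdgeLabeledTree X M T × Explains X M T ε

-- Restrict a tree explaining ε to X' and M': delete the leaves outside X' and the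
-- subtrees left without leaves, suppress every inner vertex left with a single child by
-- merging its two incident edges into one carrying the union of their labels, and
-- intersect all labels with M'. For x, y ∈ X' the vertex lca(x,y) survives, and for
-- m ∈ M' the path from it to y carries an m-edge before the restriction iff it does after.
-- Colours outside the label set M of the original tree occur neither in ε nor on any path.

module Submission where

open import Defs
open import Data.Empty using (⊥; ⊥-elim)
open import Data.Fin using (suc)
open import Data.List using (List; []; _∷_; _++_; filter)
open import Data.List.Properties using (filter-++; ++-identityʳ)
open import Data.List.Membership.Propositional using (_∈_; _∉_; lose; find)
open import Data.List.Membership.Propositional.Properties
  using (∈-filter⁺; ∈-filter⁻; ∈-++⁻; ∈-++⁺ˡ; ∈-++⁺ʳ)
open import Data.List.Membership.Setoid.Properties using (index-injective)
import Data.List.Membership.DecPropositional as DecMembership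
open import Data.List.Relation.Binary.Disjoint.Propositional using (Disjoint)
open import Data.List.Relation.Unary.All as All using (All; []; _∷_)
open import Data.List.Relation.Unary.All.Properties using (all-filter; ++⁻)
open import Data.List.Relation.Unary.Any using (Any; here; there; index)
open import Data.List.Relation.Unary.Any.Properties using (∷↔; ¬Any[])
open import Data.List.Relation.Unary.AllPairs using ([]; _∷_)
open import Data.List.Relation.Unary.Unique.Propositional using (Unique)
import Data.List.Relation.Unary.Unique.Propositional.Properties as Unique
open import Data.Maybe using (Maybe; just; nothing)
import Data.Maybe.Relation.Unary.All as Maybe
open import Data.Nat using (s≤s; z≤n)
open import Data.Product using (Σ; _×_; _,_; proj₁; proj₂)
open import Data.Product.Function.NonDependent.Propositional using (_×-⇔_)
open import Data.Sum using (_⊎_; inj₁; inj₂)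
open import Data.Sum.Function.Propositional using (_⊎-⇔_)
open import Function using (_∘_; id)
open import Function.Bundles using (_⇔_; mk⇔; Equivalence)
open import Function.Construct.Symmetry using (⇔-sym)
open import Function.Related.TypeIsomorphisms using (¬-cong-⇔)
open import Function.Construct.Composition using (_⇔-∘_)
import Function.Related.Propositional as Related
open import Level using (0ℓ)
open import Relation.Binary.Definitions using (DecidableEquality)
open import Relation.Binary.PropositionalEquality
  using (_≡_; _≢_; refl; sym; trans; subst; cong; cong₂; setoid; module ≡-Reasoning)
open import Relation.Nullary using (yes; no)
open import Relation.Unary using (Pred; Decidable)

open Equivalence using (to; from)

Unique-++⁻ : {A : Set} (xs : List A) {ys : List A} → Unique (xs ++ ys)
           → Unique xs × Unique ys × Disjoint xs ys
Unique-++⁻ [] u = [] , u , λ { (() , _) }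
Unique-++⁻ (x ∷ xs) (x∉ ∷ u) with Unique-++⁻ xs u | ++⁻ xs x∉
... | uxs , uys , disjoint | x∉xs , x∉ys = (x∉xs ∷ uxs) , uys , λ where
  (here refl , z∈ys) → All.lookup x∉ys z∈ys refl
  (there z∈xs , z∈ys) → disjoint (z∈xs , z∈ys)

∈-nonempty : {A : Set} {xs : List A} → xs ≢ [] → Σ A (_∈ xs)
∈-nonempty {xs = []} xs≢[] = ⊥-elim (xs≢[] refl)
∈-nonempty {xs = x ∷ _} _ = x , here refl

module _ {𝒳 𝒞 : Set} where

  Edge : Set
  Edge = List 𝒞 × Tree {𝒳} {𝒞}

  ∈-leavesE⁺ : ∀ {z : 𝒳} {e : Edge} {es} → e ∈ es → z ∈ leaves (proj₂ e) → z ∈ leavesE es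
  ∈-leavesE⁺ {es = (l , t) ∷ es} (here refl) z∈t = ∈-++⁺ˡ z∈t
  ∈-leavesE⁺ {es = (l , t) ∷ es} (there e∈es) z∈e = ∈-++⁺ʳ (leaves t) (∈-leavesE⁺ e∈es z∈e)

  ∈-leavesE⁻ : ∀ {z : 𝒳} (es : List Edge) → z ∈ leavesE es → Any (λ e → z ∈ leaves (proj₂ e)) es
  ∈-leavesE⁻ ((l , t) ∷ es) z∈ with ∈-++⁻ (leaves t) z∈
  ... | inj₁ z∈t = here z∈t
  ... | inj₂ z∈es = there (∈-leavesE⁻ es z∈es)

  siblings-disjoint : ∀ {e₁ e₂ : Edge} {es} → Unique (leavesE es) → (p : e₁ ∈ es) (q : e₂ ∈ es)
                    → index p ≢ index q → Disjoint (leaves (proj₂ e₁)) (leaves (proj₂ e₂))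
  siblings-disjoint u (here refl) (here refl) p≢q _ = p≢q refl
  siblings-disjoint {es = (l , t) ∷ es} u (here refl) (there q) _ (z∈t , z∈e₂) =
    proj₂ (proj₂ (Unique-++⁻ (leaves t) u)) (z∈t , ∈-leavesE⁺ q z∈e₂)
  siblings-disjoint {es = (l , t) ∷ es} u (there p) (here refl) _ (z∈e₁ , z∈t) =
    proj₂ (proj₂ (Unique-++⁻ (leaves t) u)) (z∈t , ∈-leavesE⁺ p z∈e₁)
  siblings-disjoint {es = (l , t) ∷ es} u (there p) (there q) p≢q =
    siblings-disjoint (proj₁ (proj₂ (Unique-++⁻ (leaves t) u))) p q (p≢q ∘ cong suc)

  Down⇒∈leaves : ∀ {m : 𝒞} {y : 𝒳} {t} → Down m y t → y ∈ leaves t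
  Down⇒∈leaves (here e∈ y∈t _) = ∈-leavesE⁺ e∈ y∈t
  Down⇒∈leaves (there e∈ d) = ∈-leavesE⁺ e∈ (Down⇒∈leaves d)

  LcaPath⇒∈leavesˡ : ∀ {m : 𝒞} {x y : 𝒳} {t} → LcaPath m x y t → x ∈ leaves t
  LcaPath⇒∈leavesˡ (inside e∈ x∈t _ _) = ∈-leavesE⁺ e∈ x∈t
  LcaPath⇒∈leavesˡ (split p _ _ x∈t _ _) = ∈-leavesE⁺ p x∈t

  LcaPath⇒∈leavesʳ : ∀ {m : 𝒞} {x y : 𝒳} {t} → LcaPath m x y t → y ∈ leaves t
  LcaPath⇒∈leavesʳ (inside e∈ _ y∈t _) = ∈-leavesE⁺ e∈ y∈t
  LcaPath⇒∈leavesʳ (split _ q _ _ y∈t _) = ∈-leavesE⁺ q y∈t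

  Down⇒∈labels : ∀ {M} {m : 𝒞} {y : 𝒳} {t} → WF M t → Down m y t → m ∈ M
  Down⇒∈labels (wnode _ wfs) (here e∈ _ m∈l) = All.lookup (proj₁ (All.lookup wfs e∈)) m∈l
  Down⇒∈labels (wnode _ wfs) (there e∈ d) = Down⇒∈labels (proj₂ (All.lookup wfs e∈)) d

  LcaPath⇒∈labels : ∀ {M} {m : 𝒞} {x y : 𝒳} {t} → WF M t → LcaPath m x y t → m ∈ M
  LcaPath⇒∈labels (wnode _ wfs) (inside e∈ _ _ L) = LcaPath⇒∈labels (proj₂ (All.lookup wfs e∈)) L
  LcaPath⇒∈labels (wnode _ wfs) (split _ q _ _ _ (inj₁ m∈l)) = All.lookup (proj₁ (All.lookup wfs q)) m∈l
  LcaPath⇒∈labels (wnode _ wfs) (split _ q _ _ _ (inj₂ d)) = Down⇒∈labels (proj₂ (All.lookup wfs q)) d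

  module _ (m : 𝒞) (y : 𝒳) where

    DownEdge : Edge → Set
    DownEdge (l , t) = y ∈ leaves t × (m ∈ l ⊎ Down m y t)

    Down-node : ∀ {es} → Down m y (node es) ⇔ Any DownEdge es
    Down-node = mk⇔ toAny fromAny
      where
      toAny : ∀ {es} → Down m y (node es) → Any DownEdge es
      toAny (here e∈ y∈t m∈l) = lose e∈ (y∈t , inj₁ m∈l)
      toAny (there e∈ d) = lose e∈ (Down⇒∈leaves d , inj₂ d)

      fromAny : ∀ {es} → Any DownEdge es → Down m y (node es)
      fromAny a with find a
      ... | _ , e∈ , (y∈t , inj₁ m∈l) = here e∈ y∈t m∈l
      ... | _ , e∈ , (_ , inj₂ d) = there e∈ d

    DownEdge⇒∈leavesE : ∀ {es} → Any DownEdge es → y ∈ leavesE es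
    DownEdge⇒∈leavesE a with find a
    ... | _ , e∈ , (y∈t , _) = ∈-leavesE⁺ e∈ y∈t

  module _ (m : 𝒞) (x y : 𝒳) where

    SplitEdge : Edge → Set
    SplitEdge e = x ∉ leaves (proj₂ e) × DownEdge m y e

    -- Either lca(x,y) lies below one of the child edges es, or it is the vertex itself
    -- and y hangs below a child edge that does not lead to x.
    LcaAt : List Edge → Set
    LcaAt es = Any (LcaPath m x y ∘ proj₂) es ⊎ (x ∈ leavesE es × Any SplitEdge es)

    LcaPath-node : ∀ {es} → Unique (leavesE es) → LcaPath m x y (node es) ⇔ LcaAt es
    LcaPath-node {es} u = mk⇔ toLcaAt fromLcaAt
      where
      toLcaAt : LcaPath m x y (node es) → LcaAt es
      toLcaAt (inside e∈ _ _ L) = inj₁ (lose {P = LcaPath m x y ∘ proj₂} e∈ L)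
      toLcaAt (split p q p≢q x∈t₁ y∈t₂ d) =
        inj₂ (∈-leavesE⁺ p x∈t₁ , lose {P = SplitEdge} q ((λ x∈t₂ → siblings-disjoint u p q p≢q (x∈t₁ , x∈t₂)) , y∈t₂ , d))

      fromLcaAt : LcaAt es → LcaPath m x y (node es)
      fromLcaAt (inj₁ a) with find a
      ... | _ , e∈ , L = inside e∈ (LcaPath⇒∈leavesˡ L) (LcaPath⇒∈leavesʳ L) L
      fromLcaAt (inj₂ (x∈es , a)) = split-at (find (∈-leavesE⁻ es x∈es)) (find a)
        where
        split-at : Σ Edge (λ e → e ∈ es × x ∈ leaves (proj₂ e)) → Σ Edge (λ e → e ∈ es × SplitEdge e)
                 → LcaPath m x y (node es)
        split-at (_ , p , x∈t₁) (_ , q , (x∉t₂ , y∈t₂ , d)) = split p q p≢q x∈t₁ y∈t₂ d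
          where
          p≢q : index p ≢ index q
          p≢q eq = x∉t₂ (subst (λ e → x ∈ leaves (proj₂ e)) (index-injective (setoid Edge) p q eq) x∈t₁)

  module Restriction {P : Pred 𝒳 0ℓ} (P? : Decidable P) {Q : Pred 𝒞 0ℓ} (Q? : Decidable Q) where

    mergeInto : List 𝒞 → Edge → Edge
    mergeInto l (l₀ , t) = filter Q? (l ++ l₀) , t

    attach : List 𝒞 → Maybe Edge → List Edge → List Edge
    attach l nothing rs = rs
    attach l (just e) rs = mergeInto l e ∷ rs

    suppress : List Edge → Maybe Edge
    suppress [] = nothing
    suppress (r ∷ []) = just r
    suppress rs@(_ ∷ _ ∷ _) = just ([] , node rs)

    -- prune t is nothing if no leaf of t is in P; otherwise it is the restricted subtree,
    -- paired with the labels of the edges contracted into the edge above it.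
    mutual
      prune : Tree → Maybe Edge
      prune (leaf z) with P? z
      ... | yes _ = just ([] , leaf z)
      ... | no _ = nothing
      prune (node es) = suppress (pruneE es)

      pruneE : List Edge → List Edge
      pruneE [] = []
      pruneE ((l , t) ∷ es) = attach l (prune t) (pruneE es)

    leavesᴹ : Maybe Edge → List 𝒳
    leavesᴹ nothing = []
    leavesᴹ (just (_ , t)) = leaves t

    Onᴹ : (Edge → Set) → Maybe Edge → Set
    Onᴹ R nothing = ⊥
    Onᴹ R (just e) = R e

    leavesᴹ-suppress : ∀ rs → leavesᴹ (suppress rs) ≡ leavesE rs
    leavesᴹ-suppress [] = refl
    leavesᴹ-suppress ((l , t) ∷ []) = sym (++-identityʳ (leaves t))
    leavesᴹ-suppress (_ ∷ _ ∷ _) = refl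

    leavesE-attach : ∀ l mr rs → leavesE (attach l mr rs) ≡ leavesᴹ mr ++ leavesE rs
    leavesE-attach l nothing rs = refl
    leavesE-attach l (just _) rs = refl

    mutual
      leaves-prune : ∀ t → leavesᴹ (prune t) ≡ filter P? (leaves t)
      leaves-prune (leaf z) with P? z
      ... | yes _ = refl
      ... | no _ = refl
      leaves-prune (node es) = trans (leavesᴹ-suppress (pruneE es)) (leavesE-pruneE es)

      leavesE-pruneE : ∀ es → leavesE (pruneE es) ≡ filter P? (leavesE es)
      leavesE-pruneE [] = refl
      leavesE-pruneE ((l , t) ∷ es) = begin
        leavesE (attach l (prune t) (pruneE es))        ≡⟨ leavesE-attach l (prune t) (pruneE es) ⟩
        leavesᴹ (prune t) ++ leavesE (pruneE es)        ≡⟨ cong₂ _++_ (leaves-prune t) (leavesE-pruneE es) ⟩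
        filter P? (leaves t) ++ filter P? (leavesE es)  ≡⟨ filter-++ P? (leaves t) (leavesE es) ⟨
        filter P? (leaves t ++ leavesE es)              ∎
        where open ≡-Reasoning

    ∈-filtered : ∀ {z xs ys} → ys ≡ filter P? xs → P z → z ∈ xs ⇔ z ∈ ys
    ∈-filtered ys≡ Pz = mk⇔ (λ z∈xs → subst (_ ∈_) (sym ys≡) (∈-filter⁺ P? z∈xs Pz))
                             (λ z∈ys → proj₁ (∈-filter⁻ P? (subst (_ ∈_) ys≡ z∈ys)))

    prune≢nothing : ∀ t {z} → P z → z ∈ leaves t → prune t ≢ nothing
    prune≢nothing t Pz z∈t eq with subst (λ mr → _ ∈ leavesᴹ mr) eq (to (∈-filtered (leaves-prune t) Pz) z∈t)
    ... | ()

    Unique-pruneE : ∀ es → Unique (leavesE es) → Unique (leavesE (pruneE es))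
    Unique-pruneE es u = subst Unique (sym (leavesE-pruneE es)) (Unique.filter⁺ P? u)

    module _ {M : List 𝒞} (Q⊆M : ∀ {c} → Q c → c ∈ M) where

      EdgeWF : Edge → Set
      EdgeWF e = All (_∈ M) (proj₁ e) × WF M (proj₂ e)

      suppress-WF : ∀ rs → All EdgeWF rs → Maybe.All EdgeWF (suppress rs)
      suppress-WF [] _ = Maybe.nothing
      suppress-WF (r ∷ []) (wf ∷ []) = Maybe.just wf
      suppress-WF (_ ∷ _ ∷ _) wfs = Maybe.just ([] , wnode (s≤s (s≤s z≤n)) wfs)

      attach-WF : ∀ l {mr rs} → Maybe.All EdgeWF mr → All EdgeWF rs → All EdgeWF (attach l mr rs)
      attach-WF l Maybe.nothing wfs = wfs
      attach-WF l {just (l₀ , _)} (Maybe.just (_ , wf)) wfs = (All.map Q⊆M (all-filter Q? (l ++ l₀)) , wf) ∷ wfs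

      mutual
        prune-WF : ∀ t → Maybe.All EdgeWF (prune t)
        prune-WF (leaf z) with P? z
        ... | yes _ = Maybe.just ([] , wleaf z)
        ... | no _ = Maybe.nothing
        prune-WF (node es) = suppress-WF (pruneE es) (pruneE-WF es)

        pruneE-WF : ∀ es → All EdgeWF (pruneE es)
        pruneE-WF [] = []
        pruneE-WF ((l , t) ∷ es) = attach-WF l (prune-WF t) (pruneE-WF es)

    Any-attach : ∀ {R : Edge → Set} l mr rs
               → Any R (attach l mr rs) ⇔ (Onᴹ (R ∘ mergeInto l) mr ⊎ Any R rs)
    Any-attach l nothing rs = mk⇔ inj₂ λ { (inj₁ ()) ; (inj₂ a) → a }
    Any-attach {R} l (just e) rs = ⇔-sym (Related.↔⇒ (∷↔ R))

    PruneInvariant : (Edge → Set) → Edge → Set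
    PruneInvariant R (l , t) = R (l , t) ⇔ Onᴹ (R ∘ mergeInto l) (prune t)

    Any-pruneE : ∀ {R} es → All (PruneInvariant R) es → Any R es ⇔ Any R (pruneE es)
    Any-pruneE [] [] = mk⇔ id id
    Any-pruneE {R} ((l , t) ∷ es) (inv ∷ invs) = begin
      Any R ((l , t) ∷ es)                                  ↔⟨ ∷↔ R ⟨
      (R (l , t) ⊎ Any R es)                                ∼⟨ inv ⊎-⇔ Any-pruneE es invs ⟩
      (Onᴹ (R ∘ mergeInto l) (prune t) ⊎ Any R (pruneE es)) ∼⟨ ⇔-sym (Any-attach l (prune t) (pruneE es)) ⟩
      Any R (attach l (prune t) (pruneE es))                ∎
      where open Related.EquationalReasoning

    module _ (m : 𝒞) (y : 𝒳) where

      suppress-Down : ∀ rs → Any (DownEdge m y) rs ⇔ Onᴹ (DownEdge m y) (suppress rs)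
      suppress-Down [] = mk⇔ (λ ()) (λ ())
      suppress-Down (r ∷ []) = mk⇔ (λ { (here d) → d }) here
      suppress-Down (_ ∷ _ ∷ _) =
        mk⇔ (λ a → DownEdge⇒∈leavesE m y a , inj₂ (from (Down-node m y) a))
            (λ { (_ , inj₂ d) → to (Down-node m y) d })

    module _ (m : 𝒞) (x y : 𝒳) where

      suppress-LcaAt : ∀ rs → Unique (leavesE rs) → LcaAt m x y rs ⇔ Onᴹ (LcaPath m x y ∘ proj₂) (suppress rs)
      suppress-LcaAt [] _ = mk⇔ (λ { (inj₁ ()) ; (inj₂ (_ , ())) }) (λ ())
      suppress-LcaAt ((l , t) ∷ []) _ = mk⇔ single (inj₁ ∘ here)
        where
        single : LcaAt m x y ((l , t) ∷ []) → LcaPath m x y t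
        single (inj₁ (here L)) = L
        single (inj₂ (x∈ , here (x∉t , _))) = ⊥-elim (x∉t (subst (x ∈_) (++-identityʳ (leaves t)) x∈))
      suppress-LcaAt (_ ∷ _ ∷ _) u = ⇔-sym (LcaPath-node m x y u)

    module _ {m : 𝒞} {y : 𝒳} (Qm : Q m) (Py : P y) where

      DownEdge-mergeInto : ∀ l t mr → y ∈ leaves t ⇔ y ∈ leavesᴹ mr → Down m y t ⇔ Onᴹ (DownEdge m y) mr
                         → DownEdge m y (l , t) ⇔ Onᴹ (DownEdge m y ∘ mergeInto l) mr
      DownEdge-mergeInto l t nothing y∈ _ = mk⇔ (λ { (y∈t , _) → ¬Any[] (to y∈ y∈t) }) (λ ())
      DownEdge-mergeInto l t (just (l₀ , t′)) y∈ D = mk⇔ down⁺ down⁻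
        where
        down⁺ : DownEdge m y (l , t) → DownEdge m y (mergeInto l (l₀ , t′))
        down⁺ (y∈t , inj₁ m∈l) = to y∈ y∈t , inj₁ (∈-filter⁺ Q? (∈-++⁺ˡ m∈l) Qm)
        down⁺ (_ , inj₂ d) with to D d
        ... | y∈t′ , inj₁ m∈l₀ = y∈t′ , inj₁ (∈-filter⁺ Q? (∈-++⁺ʳ l m∈l₀) Qm)
        ... | y∈t′ , inj₂ d′ = y∈t′ , inj₂ d′

        down⁻ : DownEdge m y (mergeInto l (l₀ , t′)) → DownEdge m y (l , t)
        down⁻ (y∈t′ , inj₁ m∈) with ∈-++⁻ l (proj₁ (∈-filter⁻ Q? m∈))
        ... | inj₁ m∈l = from y∈ y∈t′ , inj₁ m∈l
        ... | inj₂ m∈l₀ = from y∈ y∈t′ , inj₂ (from D (y∈t′ , inj₁ m∈l₀))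
        down⁻ (y∈t′ , inj₂ d′) = from y∈ y∈t′ , inj₂ (from D (y∈t′ , inj₂ d′))

      mutual
        Down-prune : ∀ t → Down m y t ⇔ Onᴹ (DownEdge m y) (prune t)
        Down-prune (leaf z) with P? z
        ... | yes _ = mk⇔ (λ ()) (λ { (_ , inj₁ ()) ; (_ , inj₂ ()) })
        ... | no _ = mk⇔ (λ ()) (λ ())
        Down-prune (node es) = begin
          Down m y (node es)                        ∼⟨ Down-node m y ⟩
          Any (DownEdge m y) es                     ∼⟨ Any-pruneE es (DownEdge-invariant es) ⟩
          Any (DownEdge m y) (pruneE es)            ∼⟨ suppress-Down m y (pruneE es) ⟩
          Onᴹ (DownEdge m y) (suppress (pruneE es)) ∎
          where open Related.EquationalReasoning

        DownEdge-invariant : ∀ es → All (PruneInvariant (DownEdge m y)) es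
        DownEdge-invariant [] = []
        DownEdge-invariant ((l , t) ∷ es) =
          DownEdge-mergeInto l t (prune t) (∈-filtered (leaves-prune t) Py) (Down-prune t)
          ∷ DownEdge-invariant es

      SplitEdge-mergeInto : ∀ {x} l t mr → x ∈ leaves t ⇔ x ∈ leavesᴹ mr → y ∈ leaves t ⇔ y ∈ leavesᴹ mr
                          → Down m y t ⇔ Onᴹ (DownEdge m y) mr
                          → SplitEdge m x y (l , t) ⇔ Onᴹ (SplitEdge m x y ∘ mergeInto l) mr
      SplitEdge-mergeInto l t nothing _ y∈ D = mk⇔ (to (DownEdge-mergeInto l t nothing y∈ D) ∘ proj₂) (λ ())
      SplitEdge-mergeInto l t (just e) x∈ y∈ D = ¬-cong-⇔ x∈ ×-⇔ DownEdge-mergeInto l t (just e) y∈ D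

      module _ {x : 𝒳} (Px : P x) where

        SplitEdge-invariant : ∀ es → All (PruneInvariant (SplitEdge m x y)) es
        SplitEdge-invariant [] = []
        SplitEdge-invariant ((l , t) ∷ es) =
          SplitEdge-mergeInto l t (prune t) (∈-filtered (leaves-prune t) Px) (∈-filtered (leaves-prune t) Py)
                              (Down-prune t)
          ∷ SplitEdge-invariant es

        mutual
          LcaPath-prune : ∀ t → Unique (leaves t) → LcaPath m x y t ⇔ Onᴹ (LcaPath m x y ∘ proj₂) (prune t)
          LcaPath-prune (leaf z) _ with P? z
          ... | yes _ = mk⇔ (λ ()) (λ ())
          ... | no _ = mk⇔ (λ ()) (λ ())
          LcaPath-prune (node es) u = begin
            LcaPath m x y (node es)                             ∼⟨ LcaPath-node m x y u ⟩
            LcaAt m x y es                                      ∼⟨ LcaAt-pruneE es u ⟩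
            LcaAt m x y (pruneE es)                             ∼⟨ suppress-LcaAt m x y (pruneE es) (Unique-pruneE es u) ⟩
            Onᴹ (LcaPath m x y ∘ proj₂) (suppress (pruneE es))  ∎
            where open Related.EquationalReasoning

          LcaAt-pruneE : ∀ es → Unique (leavesE es) → LcaAt m x y es ⇔ LcaAt m x y (pruneE es)
          LcaAt-pruneE es u = Any-pruneE es (LcaPath-invariant es u)
                        ⊎-⇔ (∈-filtered (leavesE-pruneE es) Px ×-⇔ Any-pruneE es (SplitEdge-invariant es))

          LcaPath-invariant : ∀ es → Unique (leavesE es) → All (PruneInvariant (LcaPath m x y ∘ proj₂)) es
          LcaPath-invariant [] _ = []
          LcaPath-invariant ((l , t) ∷ es) u with Unique-++⁻ (leaves t) u
          ... | ut , ues , _ = forget-label (prune t) ⇔-∘ LcaPath-prune t ut ∷ LcaPath-invariant es ues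
            where
            forget-label : ∀ mr → Onᴹ (LcaPath m x y ∘ proj₂) mr ⇔ Onᴹ (LcaPath m x y ∘ proj₂ ∘ mergeInto l) mr
            forget-label nothing = mk⇔ id id
            forget-label (just _) = mk⇔ id id

explains-every-colour : {𝒳 𝒞 : Set} → DecidableEquality 𝒞 → ∀ {X M T} {ε : 𝒳 → 𝒳 → 𝒞 → Set}
                      → IsMap X M ε → WF M T → Explains X M T ε
                      → ∀ x y m → x ∈ X → y ∈ X → x ≢ y → ε x y m ⇔ LcaPath m x y T
explains-every-colour _≟_ {M = M} εmap wf explains x y m x∈ y∈ x≢y with m ∈? M
  where open DecMembership _≟_ using (_∈?_)
... | yes m∈M = explains x y m x∈ y∈ x≢y m∈M
... | no m∉M = mk⇔ (⊥-elim ∘ m∉M ∘ εmap x y m x∈ y∈ x≢y) (⊥-elim ∘ m∉M ∘ LcaPath⇒∈labels wf)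

module _ {𝒳 𝒞 : Set} (_≟ₓ_ : DecidableEquality 𝒳) (_≟꜀_ : DecidableEquality 𝒞)
         (X' : List 𝒳) (M' : List 𝒞) where

  open DecMembership _≟ₓ_ using () renaming (_∈?_ to _∈ₓ?_)
  open DecMembership _≟꜀_ using () renaming (_∈?_ to _∈꜀?_)
  open Restriction (_∈ₓ? X') (_∈꜀? M')

  restrict-EdgeLabeledTree : ∀ {X M T} → EdgeLabeledTree X M T → (∀ z → z ∈ X' → z ∈ X) → X' ≢ []
    → Σ Tree λ T′ → EdgeLabeledTree X' M' T′
                  × (∀ m x y → m ∈ M' → x ∈ X' → y ∈ X' → LcaPath m x y T ⇔ LcaPath m x y T′)
  restrict-EdgeLabeledTree {T = T} (wf , u , leaves⇔X) X'⊆X X'≢[] with prune T in eq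
  ... | nothing = ⊥-elim (prune≢nothing T z∈X' (from (leaves⇔X z) (X'⊆X z z∈X')) eq)
    where
    z = proj₁ (∈-nonempty X'≢[])
    z∈X' = proj₂ (∈-nonempty X'≢[])
  ... | just (_ , T′) = T′ , (WF′ , Unique′ , leaves⇔X′) , LcaPath⇔
    where
    leaves′ : leaves T′ ≡ filter (_∈ₓ? X') (leaves T)
    leaves′ = trans (cong leavesᴹ (sym eq)) (leaves-prune T)

    WF′ : WF M' T′
    WF′ = proj₂ (Maybe.drop-just (subst (Maybe.All (EdgeWF id)) eq (prune-WF id T)))

    Unique′ : Unique (leaves T′)
    Unique′ = subst Unique (sym leaves′) (Unique.filter⁺ (_∈ₓ? X') u)

    leaves⇔X′ : ∀ z → z ∈ leaves T′ ⇔ z ∈ X'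
    leaves⇔X′ z = mk⇔ (λ z∈T′ → proj₂ (∈-filter⁻ (_∈ₓ? X') {xs = leaves T} (subst (z ∈_) leaves′ z∈T′)))
                      (λ z∈X' → to (∈-filtered leaves′ z∈X') (from (leaves⇔X z) (X'⊆X z z∈X')))

    LcaPath⇔ : ∀ m x y → m ∈ M' → x ∈ X' → y ∈ X' → LcaPath m x y T ⇔ LcaPath m x y T′
    LcaPath⇔ m x y m∈ x∈ y∈ =
      subst (λ mr → LcaPath m x y T ⇔ Onᴹ (LcaPath m x y ∘ proj₂) mr) eq (LcaPath-prune m∈ y∈ x∈ T u)

corollary4 : {𝒳 𝒞 : Set} → DecidableEquality 𝒳 → DecidableEquality 𝒞
    → (X X' : List 𝒳) (M M' : List 𝒞)
    → X ≢ [] → X' ≢ [] → M ≢ [] → M' ≢ []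
    → (ε ε' : 𝒳 → 𝒳 → 𝒞 → Set)
    → IsMap X M ε → IsMap X' M' ε'
    → FitchMap X M ε
    → (∀ z → z ∈ X' → z ∈ X)
    → (∀ x y → x ∈ X' → y ∈ X' → x ≢ y → ∀ m → ε' x y m ⇔ ε x y m)
    → FitchMap X' M' ε'
corollary4 _≟ₓ_ _≟꜀_ X X' M M' _ X'≢[] _ _ ε ε' εmap _ (T , tree@(wf , _) , explains) X'⊆X ε'⇔ε
  with restrict-EdgeLabeledTree _≟ₓ_ _≟꜀_ X' M' tree X'⊆X X'≢[]
... | T′ , tree′ , LcaPath⇔ = T′ , tree′ , explains′
  where
  explains′ : Explains X' M' T′ ε'
  explains′ x y m x∈ y∈ x≢y m∈ = begin
    ε' x y m          ∼⟨ ε'⇔ε x y x∈ y∈ x≢y m ⟩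
    ε x y m           ∼⟨ explains-every-colour _≟꜀_ εmap wf explains x y m (X'⊆X x x∈) (X'⊆X y y∈) x≢y ⟩
    LcaPath m x y T   ∼⟨ LcaPath⇔ m x y m∈ x∈ y∈ ⟩
    LcaPath m x y T′  ∎
    where open Related.EquationalReasoning
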